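{- Let $\rho\subset\mathbb{Z}_+^d$ be the shape of some $d$-dimensional partition, with $|\rho|$ its number of elements. Then $$\sum_{\pi \in \mathcal{P}^{(d)},\ \mathrm{sh}(\pi) \subseteq \rho} t^{\mathrm{cor}(\pi)} = (1 - t)^{ -|\rho|},\qquad \sum_{\pi \in \mathcal{P}^{(d)},\ \mathrm{sh}(\pi) = \rho} t^{\mathrm{cor}(\pi)} = t^{\mathrm{cr}(\rho)} (1 - t)^{ -|\rho|}.$$ Consequently, for each $k$, the number of $\pi\in\mathcal{P}^{(d)}$ with $\mathrm{sh}(\pi)=\rho$ and $\mathrm{cor}(\pi)=k$ equals $\binom{k-\mathrm{cr}(\rho)+|\rho|-1}{|\rho|-1}$.
   Context: A $d$-dimensional partition is an array $\pi=(\pi_{\mathbf{i}})_{\mathbf{i}\in\mathbb{Z}_+^d}$ of nonnegative integers with finitely many nonzero entries, weakly decreasing in each coordinate; $\mathcal{P}^{(d)}$ is their set; $\mathrm{sh}(\pi)=\{\mathbf{i}:\pi_{\mathbf{i}}>0\}$. A shape of a $d$-dimensional partition is a finite downward-closed subset of $\mathbb{Z}_+^d$. $D(\pi)=\{(i_1,\ldots,i_d,i)\in\mathbb{Z}_+^{d+1}:1\le i\le\pi_{i_1,\ldots,i_d}\}$, $\mathrm{Cor}(\pi)=\{\mathbf{i}\in D(\pi):\mathbf{i}+\mathbf{e}_\ell\notin D(\pi)\ \forall\ell\in[d]\}$, $\mathrm{cor}(\pi)=|\mathrm{Cor}(\pi)|$. For a shape $\rho$, $\mathrm{Cr}(\rho)=\{\mathbf{i}\in\rho:\mathbf{i}+\mathbf{e}_\ell\notin\rho\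 \forall\ell\in[d]\}$ and $\mathrm{cr}(\rho)=|\mathrm{Cr}(\rho)|$. -}

module Defs where

open import Data.Nat using (ℕ; zero; suc; _≤_; _<_; _∸_; _+_)
open import Data.Nat.Combinatorics using (_C_)
open import Data.Integer as ℤ using (ℤ; +_; -[1+_])
open import Data.Fin using (Fin)
open import Data.Vec using (Vec; _[_]%=_)
open import Data.List using (List; upTo; map; foldr)
open import Data.List.Membership.Propositional using (_∈_)
open import Data.Product using (Σ; _×_; ∃; _,_)
open import Relation.Binary.PropositionalEquality using (_≡_; _≢_)
open import Relation.Nullary using (¬_)

-- Indices: Z_+^d is encoded 0-based as Vec ℕ d (coordinate c ↦ c+1).
Idx : ℕ → Set
Idx d = Vec ℕ d

_+e_ : ∀ {d} → Idx d → Fin d → Idx d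
i +e ℓ = i [ ℓ ]%= suc

HasCount : {A : Set} → (A → A → Set) → (A → Set) → ℕ → Set
HasCount {A} _≈_ P N =
  Σ (Fin N → A) λ f →
    (∀ j → P (f j)) ×
    (∀ j j' → f j ≈ f j' → j ≡ j') ×
    (∀ x → P x → ∃ λ j → x ≈ f j)

_≗ₐ_ : ∀ {d} → (Idx d → ℕ) → (Idx d → ℕ) → Set
π ≗ₐ σ = ∀ i → π i ≡ σ i

IsPartition : ∀ {d} → (Idx d → ℕ) → Set
IsPartition {d} π =
  (∀ (i : Idx d) (ℓ : Fin d) → π (i +e ℓ) ≤ π i) ×
  (Σ (List (Idx d)) λ L → ∀ i → π i ≢ 0 → i ∈ L)

ShSub : ∀ {d} → (Idx d → ℕ) → (Idx d → ℕ) → Set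
ShSub π σ = ∀ i → π i ≢ 0 → σ i ≢ 0

ShEq : ∀ {d} → (Idx d → ℕ) → (Idx d → ℕ) → Set
ShEq π σ = ShSub π σ × ShSub σ π

-- D(π): points (i , h) with 1 ≤ h ≤ π i  (last coordinate 1-based)
InD : ∀ {d} → (Idx d → ℕ) → Idx d × ℕ → Set
InD π (i , h) = 1 ≤ h × h ≤ π i

InCor : ∀ {d} → (Idx d → ℕ) → Idx d × ℕ → Set
InCor {d} π (i , h) = InD π (i , h) × (∀ (ℓ : Fin d) → ¬ InD π (i +e ℓ , h))

CorIs : ∀ {d} → (Idx d → ℕ) → ℕ → Set
CorIs π k = HasCount _≡_ (InCor π) k

-- membership in the shape ρ = sh(π₀)
InSh : ∀ {d} → (Idx d → ℕ) → Idx d → Set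
InSh π₀ i = π₀ i ≢ 0

InCr : ∀ {d} → (Idx d → ℕ) → Idx d → Set
InCr {d} π₀ i = InSh π₀ i × (∀ (ℓ : Fin d) → ¬ InSh π₀ (i +e ℓ))

Series : Set
Series = ℕ → ℤ

sumℤ : List ℤ → ℤ
sumℤ = foldr ℤ._+_ (+ 0)

_⋆_ : Series → Series → Series
(f ⋆ g) k = sumℤ (map (λ i → f i ℤ.* g (k ∸ i)) (upTo (suc k)))

tPow : ℕ → Series
tPow c k with c Data.Nat.≟ k
... | Relation.Nullary.yes _ = + 1
... | Relation.Nullary.no _ = + 0

oneMinusT : Series
oneMinusT zero = + 1
oneMinusT (suc zero) = -[1+ 0 ]
oneMinusT (suc (suc _)) = + 0

oneMinusTPow : ℕ → Series
oneMinusTPow zero = tPow 0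
oneMinusTPow (suc n) = oneMinusT ⋆ oneMinusTPow n

-- series a equals (1-t)^{-n} * t^c, i.e. a * (1-t)^n = t^c coefficientwise
SeriesEq : Series → Series → Set
SeriesEq f g = ∀ k → f k ≡ g k

-- A partition π with sh(π) ⊆ ρ is determined by its corner counts x(i) = π(i) ∸ max_ℓ π(i + e_ℓ)
-- (the number of corners in column i), and these can be prescribed arbitrarily on ρ: π is rebuilt
-- from the top of ρ downwards by π(i) = x(i) + max_ℓ π(i + e_ℓ). Since cor(π) = Σ x, partitions
-- inside ρ with k corners are weak compositions of k into |ρ| parts, counted by (1 - t)^-|ρ|.
-- The shape is exactly ρ iff x is positive on Cr(ρ); subtracting 1 there shifts the series by t^cr(ρ).
module Submission where

open import Defs
open import Data.Nat using (ℕ; zero; suc)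
open import Data.Fin using (Fin; zero; suc; toℕ)
open import Data.Product using (Σ; ∃; _×_; _,_; proj₁; proj₂)
open import Function using (_∘_)
open import Relation.Binary.PropositionalEquality

shift : {A : Set} → A → ℕ → (ℕ → A) → ℕ → A
shift z zero    f k       = f k
shift z (suc c) f zero    = z
shift z (suc c) f (suc k) = shift z c f k

shift-cong : {A : Set} {z : A} (c : ℕ) {f f' : ℕ → A} → f ≗ f' → shift z c f ≗ shift z c f'
shift-cong zero    eq k       = eq k
shift-cong (suc c) eq zero    = refl
shift-cong (suc c) eq (suc k) = shift-cong c eq k

map-shift : {A B : Set} (h : A → B) (z : A) (c : ℕ) (f : ℕ → A) →
            h ∘ shift z c f ≗ shift (h z) c (h ∘ f)
map-shift h z zero    f k       = refl
map-shift h z (suc c) f zero    = refl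
map-shift h z (suc c) f (suc k) = map-shift h z c f k

module FormalPowerSeries where

  open import Data.Nat using (_∸_; _<_; z≤n; s≤s)
  import Data.Nat as ℕ
  import Data.Nat.Properties as ℕₚ
  open import Data.Integer using (ℤ; +_; -[1+_]; _+_; _*_; _-_)
  import Data.Integer.Properties as ℤ
  open import Data.Integer.Tactic.RingSolver using (solve-∀)
  open import Data.List using (applyUpTo)
  open import Data.List.Properties using (map-upTo)
  open import Relation.Nullary using (yes; no; contradiction)

  sumBelow : (ℕ → ℤ) → ℕ → ℤ
  sumBelow h n = sumℤ (applyUpTo h n)

  sumBelow-cong : ∀ h h' n → (∀ i → i < n → h i ≡ h' i) → sumBelow h n ≡ sumBelow h' n
  sumBelow-cong h h' zero    eq = refl
  sumBelow-cong h h' (suc n) eq =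
    cong₂ _+_ (eq 0 (s≤s z≤n)) (sumBelow-cong (h ∘ suc) (h' ∘ suc) n (λ i i<n → eq (suc i) (s≤s i<n)))

  sumBelow-zero : ∀ h n → (∀ i → h i ≡ + 0) → sumBelow h n ≡ + 0
  sumBelow-zero h zero    eq = refl
  sumBelow-zero h (suc n) eq = cong₂ _+_ (eq 0) (sumBelow-zero (h ∘ suc) n (eq ∘ suc))

  sumBelow-sub : ∀ h h' n → sumBelow (λ i → h i - h' i) n ≡ sumBelow h n - sumBelow h' n
  sumBelow-sub h h' zero    = refl
  sumBelow-sub h h' (suc n) =
    trans (cong (λ s → h 0 - h' 0 + s) (sumBelow-sub (h ∘ suc) (h' ∘ suc) n)) (interchange (h 0) (h' 0) _ _)
    where
    interchange : ∀ a b c d → (a - b) + (c - d) ≡ (a + c) - (b + d)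
    interchange = solve-∀

  sumBelow-snoc : ∀ h n → sumBelow h (suc n) ≡ sumBelow h n + h n
  sumBelow-snoc h zero    = trans (ℤ.+-identityʳ (h 0)) (sym (ℤ.+-identityˡ (h 0)))
  sumBelow-snoc h (suc n) =
    trans (cong (λ s → h 0 + s) (sumBelow-snoc (h ∘ suc) n)) (sym (ℤ.+-assoc (h 0) _ _))

  sumBelow-reverse : ∀ h n → sumBelow h n ≡ sumBelow (λ i → h (n ∸ suc i)) n
  sumBelow-reverse h zero    = refl
  sumBelow-reverse h (suc n) = begin
    h 0 + sumBelow (h ∘ suc) n
      ≡⟨ cong (λ s → h 0 + s) (sumBelow-reverse (h ∘ suc) n) ⟩
    h 0 + sumBelow (λ i → h (suc (n ∸ suc i))) n
      ≡⟨ ℤ.+-comm (h 0) _ ⟩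
    sumBelow (λ i → h (suc (n ∸ suc i))) n + h 0
      ≡⟨ cong₂ _+_ (sumBelow-cong _ _ n (λ i i<n → cong h (sym (ℕₚ.+-∸-assoc 1 i<n))))
                   (cong h (sym (ℕₚ.n∸n≡0 n))) ⟩
    sumBelow (λ i → h (suc n ∸ suc i)) n + h (suc n ∸ suc n)
      ≡⟨ sumBelow-snoc (λ i → h (suc n ∸ suc i)) n ⟨
    sumBelow (λ i → h (suc n ∸ suc i)) (suc n) ∎
    where open ≡-Reasoning

  ⋆-unfold : ∀ f g k → (f ⋆ g) k ≡ sumBelow (λ i → f i * g (k ∸ i)) (suc k)
  ⋆-unfold f g k = cong sumℤ (map-upTo (λ i → f i * g (k ∸ i)) (suc k))

  ⋆-comm : ∀ f g → f ⋆ g ≗ g ⋆ f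
  ⋆-comm f g k = begin
    (f ⋆ g) k                                            ≡⟨ ⋆-unfold f g k ⟩
    sumBelow (λ i → f i * g (k ∸ i)) (suc k)             ≡⟨ sumBelow-reverse (λ i → f i * g (k ∸ i)) (suc k) ⟩
    sumBelow (λ i → f (k ∸ i) * g (k ∸ (k ∸ i))) (suc k) ≡⟨ sumBelow-cong _ _ (suc k) swap ⟩
    sumBelow (λ i → g i * f (k ∸ i)) (suc k)             ≡⟨ ⋆-unfold g f k ⟨
    (g ⋆ f) k                                            ∎
    where
    open ≡-Reasoning
    swap : ∀ i → i < suc k → f (k ∸ i) * g (k ∸ (k ∸ i)) ≡ g i * f (k ∸ i)
    swap i i<1+k = trans (cong (λ j → f (k ∸ i) * g j) (ℕₚ.m∸[m∸n]≡n (ℕₚ.≤-pred i<1+k)))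
                         (ℤ.*-comm (f (k ∸ i)) (g i))

  ⋆-congˡ : ∀ {f f'} g → f ≗ f' → f ⋆ g ≗ f' ⋆ g
  ⋆-congˡ {f} {f'} g eq k =
    trans (⋆-unfold f g k)
      (trans (sumBelow-cong _ _ (suc k) (λ i _ → cong (_* g (k ∸ i)) (eq i))) (sym (⋆-unfold f' g k)))

  ⋆-identityˡ : ∀ g → tPow 0 ⋆ g ≗ g
  ⋆-identityˡ g k = begin
    (tPow 0 ⋆ g) k                                                   ≡⟨ ⋆-unfold (tPow 0) g k ⟩
    + 1 * g k + sumBelow (λ i → tPow 0 (suc i) * g (k ∸ suc i)) k    ≡⟨ cong (λ s → + 1 * g k + s) (sumBelow-zero _ k (λ i → ℤ.*-zeroˡ (g (k ∸ suc i)))) ⟩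
    + 1 * g k + + 0                                                  ≡⟨ ℤ.+-identityʳ _ ⟩
    + 1 * g k                                                        ≡⟨ ℤ.*-identityˡ (g k) ⟩
    g k                                                              ∎
    where open ≡-Reasoning

  Δ : Series → Series
  Δ f zero    = f 0
  Δ f (suc k) = f (suc k) - f k

  Δ-cong : ∀ {f f'} → f ≗ f' → Δ f ≗ Δ f'
  Δ-cong eq zero    = eq 0
  Δ-cong eq (suc k) = cong₂ _-_ (eq (suc k)) (eq k)

  Δ-partialSums : ∀ (f g : ℕ → ℕ) → f 0 ≡ g 0 → (∀ k → f (suc k) ≡ f k ℕ.+ g (suc k)) →
                  Δ (+_ ∘ f) ≗ +_ ∘ g
  Δ-partialSums f g f₀ f-suc zero    = cong +_ f₀
  Δ-partialSums f g f₀ f-suc (suc k) = begin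
    + f (suc k) - + f k             ≡⟨ cong (λ v → + v - + f k) (f-suc k) ⟩
    + (f k ℕ.+ g (suc k)) - + f k   ≡⟨ cong (_- + f k) (ℤ.pos-+ (f k) (g (suc k))) ⟩
    + f k + + g (suc k) - + f k     ≡⟨ cancel (+ f k) (+ g (suc k)) ⟩
    + g (suc k)                     ∎
    where
    open ≡-Reasoning
    cancel : ∀ a b → a + b - a ≡ b
    cancel = solve-∀

  oneMinusT-⋆ : ∀ g → oneMinusT ⋆ g ≗ Δ g
  oneMinusT-⋆ g zero    = trans (ℤ.+-identityʳ _) (ℤ.*-identityˡ (g 0))
  oneMinusT-⋆ g (suc k) = begin
    (oneMinusT ⋆ g) (suc k)
      ≡⟨ ⋆-unfold oneMinusT g (suc k) ⟩
    + 1 * g (suc k) + (-[1+ 0 ] * g k + sumBelow (λ i → oneMinusT (suc (suc i)) * g (k ∸ suc i)) k)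
      ≡⟨ cong (λ s → + 1 * g (suc k) + (-[1+ 0 ] * g k + s)) (sumBelow-zero _ k (λ i → ℤ.*-zeroˡ (g (k ∸ suc i)))) ⟩
    + 1 * g (suc k) + (-[1+ 0 ] * g k + + 0)
      ≡⟨ normalise (g (suc k)) (g k) ⟩
    g (suc k) - g k ∎
    where
    open ≡-Reasoning
    normalise : ∀ a b → + 1 * a + (-[1+ 0 ] * b + + 0) ≡ a - b
    normalise = solve-∀

  Δ-⋆ : ∀ f g → Δ f ⋆ g ≗ Δ (f ⋆ g)
  Δ-⋆ f g zero    = trans (⋆-unfold (Δ f) g 0) (sym (⋆-unfold f g 0))
  Δ-⋆ f g (suc k) = begin
    (Δ f ⋆ g) (suc k)
      ≡⟨ ⋆-unfold (Δ f) g (suc k) ⟩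
    f 0 * g (suc k) + sumBelow (λ i → (f (suc i) - f i) * g (k ∸ i)) (suc k)
      ≡⟨ cong (λ s → f 0 * g (suc k) + s) (sumBelow-cong _ _ (suc k) (λ i _ → distribʳ (f (suc i)) (f i) (g (k ∸ i)))) ⟩
    f 0 * g (suc k) + sumBelow (λ i → f (suc i) * g (k ∸ i) - f i * g (k ∸ i)) (suc k)
      ≡⟨ cong (λ s → f 0 * g (suc k) + s) (sumBelow-sub (λ i → f (suc i) * g (k ∸ i)) (λ i → f i * g (k ∸ i)) (suc k)) ⟩
    f 0 * g (suc k) + (sumBelow (λ i → f (suc i) * g (k ∸ i)) (suc k) - sumBelow (λ i → f i * g (k ∸ i)) (suc k))
      ≡⟨ ℤ.+-assoc (f 0 * g (suc k)) _ _ ⟨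
    f 0 * g (suc k) + sumBelow (λ i → f (suc i) * g (k ∸ i)) (suc k) - sumBelow (λ i → f i * g (k ∸ i)) (suc k)
      ≡⟨ cong₂ _-_ (⋆-unfold f g (suc k)) (⋆-unfold f g k) ⟨
    Δ (f ⋆ g) (suc k) ∎
    where
    open ≡-Reasoning
    distribʳ : ∀ a b c → (a - b) * c ≡ a * c - b * c
    distribʳ = solve-∀

  -- G plays the role of n ↦ (1 - t)⁻ⁿ: each G (suc n) is the partial-sum series of G n.
  ⋆-oneMinusTPow : (G : ℕ → Series) → G 0 ≗ tPow 0 → (∀ n → Δ (G (suc n)) ≗ G n) →
                   ∀ n → G n ⋆ oneMinusTPow n ≗ tPow 0
  ⋆-oneMinusTPow G G₀ ΔG zero    k = trans (⋆-congˡ (tPow 0) G₀ k) (⋆-identityˡ (tPow 0) k)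
  ⋆-oneMinusTPow G G₀ ΔG (suc n) k = begin
    (G (suc n) ⋆ (oneMinusT ⋆ Q)) k ≡⟨ ⋆-comm (G (suc n)) (oneMinusT ⋆ Q) k ⟩
    ((oneMinusT ⋆ Q) ⋆ G (suc n)) k ≡⟨ ⋆-congˡ (G (suc n)) (oneMinusT-⋆ Q) k ⟩
    (Δ Q ⋆ G (suc n)) k             ≡⟨ Δ-⋆ Q (G (suc n)) k ⟩
    Δ (Q ⋆ G (suc n)) k             ≡⟨ Δ-cong (⋆-comm Q (G (suc n))) k ⟩
    Δ (G (suc n) ⋆ Q) k             ≡⟨ Δ-⋆ (G (suc n)) Q k ⟨
    (Δ (G (suc n)) ⋆ Q) k           ≡⟨ ⋆-congˡ Q (ΔG n) k ⟩
    (G n ⋆ Q) k                     ≡⟨ ⋆-oneMinusTPow G G₀ ΔG n k ⟩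
    tPow 0 k                        ∎
    where
    open ≡-Reasoning
    Q = oneMinusTPow n

  shift-⋆ : ∀ c f g → shift (+ 0) c f ⋆ g ≗ shift (+ 0) c (f ⋆ g)
  shift-⋆ zero    f g k       = refl
  shift-⋆ (suc c) f g zero    = trans (ℤ.+-identityʳ _) (ℤ.*-zeroˡ (g 0))
  shift-⋆ (suc c) f g (suc k) = begin
    (shift (+ 0) (suc c) f ⋆ g) (suc k)
      ≡⟨ ⋆-unfold (shift (+ 0) (suc c) f) g (suc k) ⟩
    + 0 * g (suc k) + sumBelow (λ i → shift (+ 0) c f i * g (k ∸ i)) (suc k)
      ≡⟨ cong (_+ sumBelow (λ i → shift (+ 0) c f i * g (k ∸ i)) (suc k)) (ℤ.*-zeroˡ (g (suc k))) ⟩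
    + 0 + sumBelow (λ i → shift (+ 0) c f i * g (k ∸ i)) (suc k)
      ≡⟨ ℤ.+-identityˡ _ ⟩
    sumBelow (λ i → shift (+ 0) c f i * g (k ∸ i)) (suc k)
      ≡⟨ ⋆-unfold (shift (+ 0) c f) g k ⟨
    (shift (+ 0) c f ⋆ g) k
      ≡⟨ shift-⋆ c f g k ⟩
    shift (+ 0) c (f ⋆ g) k ∎
    where open ≡-Reasoning

  tPow-suc : ∀ c k → tPow c k ≡ tPow (suc c) (suc k)
  tPow-suc c k with c ℕₚ.≟ k | suc c ℕₚ.≟ suc k
  ... | yes _   | yes _   = refl
  ... | no _    | no _    = refl
  ... | yes c≡k | no c≢k  = contradiction (cong suc c≡k) c≢k
  ... | no c≢k  | yes c≡k = contradiction (ℕₚ.suc-injective c≡k) c≢k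

  shift-tPow : ∀ c → shift (+ 0) c (tPow 0) ≗ tPow c
  shift-tPow zero    k       = refl
  shift-tPow (suc c) zero    = refl
  shift-tPow (suc c) (suc k) = trans (shift-tPow c k) (tPow-suc c k)

  shift-⋆-tPow : ∀ c {f} g → f ⋆ g ≗ tPow 0 → shift (+ 0) c f ⋆ g ≗ tPow c
  shift-⋆-tPow c {f} g f⋆g≗1 k =
    trans (shift-⋆ c f g k) (trans (shift-cong c f⋆g≗1 k) (shift-tPow c k))

open FormalPowerSeries using (⋆-congˡ; ⋆-oneMinusTPow; Δ-partialSums; shift-⋆-tPow)

-- ℕ arithmetic is opened only after the ℤ-valued FormalPowerSeries, so that the two do not clash.
open import Data.Nat using (_+_; _∸_; _≤_; _<_; _≥_; z≤n; s≤s; s≤s⁻¹; _≟_; _⊔_)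
open import Data.Nat.Properties
open import Data.Nat.Combinatorics using (_C_; nCn≡1; nCk+nC[k+1]≡[n+1]C[k+1])
open import Algebra.Properties.CommutativeMonoid.Sum +-0-commutativeMonoid
  using (sum; sum-cong-≗; sum-init-last; ∑-distrib-+)
open import Data.Fin using (fromℕ<; inject₁; fromℕ)
open import Data.Fin.Properties
  using (toℕ-injective; toℕ-fromℕ<; toℕ<n; toℕ-inject₁; toℕ-fromℕ; +↔⊎; injective⇒≤; all?; ¬∀⟶∃¬)
open import Data.Vec.Functional using (_∷_)
import Data.Vec as Vec
open import Data.List using (tabulate)
open import Data.List.Membership.Propositional using (_∈_)
open import Data.List.Membership.Propositional.Properties using (∈-tabulate⁺)
open import Data.Sum using (_⊎_; inj₁; inj₂)
open import Data.Sum.Function.Propositional using (_⊎-↔_)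
open import Data.Unit using (⊤; tt)
open import Function.Bundles using (_↔_; mk↔ₛ′; Inverse)
open import Function.Properties.Inverse using (↔-refl; ↔-trans)
open import Relation.Binary.Definitions using (Transitive)
open import Relation.Nullary using (¬_; Dec; yes; no; contradiction)
open import Relation.Nullary.Decidable using (decidable-stable; ¬?; _×-dec_)

shift-< : {A : Set} {z : A} {c k : ℕ} {f : ℕ → A} → k < c → shift z c f k ≡ z
shift-< {c = suc c} {zero}  _         = refl
shift-< {c = suc c} {suc k} (s≤s k<c) = shift-< k<c

shift-≥ : {A : Set} {z : A} {c k : ℕ} {f : ℕ → A} → c ≤ k → shift z c f k ≡ f (k ∸ c)
shift-≥ {c = zero}          _         = refl
shift-≥ {c = suc c} {suc k} (s≤s c≤k) = shift-≥ c≤k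

shift-elim : {A : Set} (Q : ℕ → A → Set) {z : A} (c : ℕ) {f : ℕ → A} →
             (∀ k → k < c → Q k z) → (∀ k → Q (c + k) (f k)) → ∀ k → Q k (shift z c f k)
shift-elim Q zero    below above k       = above k
shift-elim Q (suc c) below above zero    = below zero (s≤s z≤n)
shift-elim Q (suc c) below above (suc k) =
  shift-elim (Q ∘ suc) c (λ k k<c → below (suc k) (s≤s k<c)) above k

HasCount-unique : {A : Set} {P : A → Set} {N M : ℕ} →
                  HasCount _≡_ P N → HasCount _≡_ P M → N ≡ M
HasCount-unique cN cM = ≤-antisym (HasCount-≤ cN cM) (HasCount-≤ cM cN)
  where
  HasCount-≤ : {A : Set} {P : A → Set} {N M : ℕ} → HasCount _≡_ P N → HasCount _≡_ P M → N ≤ M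
  HasCount-≤ (f , f∈P , f-inj , _) (g , _ , _ , g-surj) = injective⇒≤ {f = index} index-inj
    where
    index = λ j → proj₁ (g-surj (f j) (f∈P j))
    index-inj : ∀ {j j'} → index j ≡ index j' → j ≡ j'
    index-inj {j} {j'} eq = f-inj j j'
      (trans (proj₂ (g-surj _ (f∈P j))) (trans (cong g eq) (sym (proj₂ (g-surj _ (f∈P j'))))))

HasCount-↔ : {B : Set} {N : ℕ} → Fin N ↔ B → HasCount _≡_ (λ (_ : B) → ⊤) N
HasCount-↔ N↔B = to , (λ _ → tt) , to-inj , λ b _ → from b , sym (strictlyInverseˡ b)
  where
  open Inverse N↔B
  to-inj : ∀ j j' → to j ≡ to j' → j ≡ j'
  to-inj j j' eq = trans (sym (strictlyInverseʳ j)) (trans (cong from eq) (strictlyInverseʳ j'))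

HasCount-map : {A B : Set} {_≈₁_ : A → A → Set} {_≈₂_ : B → B → Set}
               {P : A → Set} {Q : B → Set} {N : ℕ} →
               Transitive _≈₂_ → HasCount _≈₁_ P N → (F : A → B) →
               (∀ {a} → P a → Q (F a)) →
               (∀ a a' → F a ≈₂ F a' → a ≈₁ a') →
               (∀ {a a'} → a ≈₁ a' → F a ≈₂ F a') →
               (∀ {b} → Q b → Σ A λ a → P a × b ≈₂ F a) →
               HasCount _≈₂_ Q N
HasCount-map {_≈₂_ = _≈₂_} {Q = Q} ≈₂-trans (f , f∈P , f-inj , f-surj) F P⇒Q F-reflects F-cong F-onto =
  F ∘ f , P⇒Q ∘ f∈P , (λ j j' eq → f-inj j j' (F-reflects _ _ eq)) , onto
  where
  onto : ∀ b → Q b → ∃ λ j → b ≈₂ F (f j)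
  onto b Qb = let (a , Pa , b≈Fa) = F-onto Qb ; (j , a≈fj) = f-surj a Pa
              in j , ≈₂-trans b≈Fa (F-cong a≈fj)

HasCount-∅ : {A : Set} {_≈_ : A → A → Set} {P : A → Set} → (∀ a → ¬ P a) → HasCount _≈_ P 0
HasCount-∅ ¬P = (λ ()) , (λ ()) , (λ ()) , λ a Pa → contradiction Pa (¬P a)

Fin-sum↔Σ : ∀ {n} (x : Fin n → ℕ) → Fin (sum x) ↔ Σ (Fin n) (Fin ∘ x)
Fin-sum↔Σ {zero}  x = mk↔ₛ′ (λ ()) (λ { (() , _) }) (λ { (() , _) }) (λ ())
Fin-sum↔Σ {suc n} x = ↔-trans +↔⊎ (↔-trans (↔-refl ⊎-↔ Fin-sum↔Σ (x ∘ suc)) ⊎↔Σ)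
  where
  ⊎↔Σ : (Fin (x zero) ⊎ Σ (Fin n) (Fin ∘ x ∘ suc)) ↔ Σ (Fin (suc n)) (Fin ∘ x)
  ⊎↔Σ = mk↔ₛ′ (λ { (inj₁ r) → zero , r ; (inj₂ (j , r)) → suc j , r })
              (λ { (zero , r) → inj₁ r ; (suc j , r) → inj₂ (j , r) })
              (λ { (zero , r) → refl ; (suc j , r) → refl })
              (λ { (inj₁ _) → refl ; (inj₂ _) → refl })

≗-trans : {A B : Set} → Transitive (_≗_ {A = A} {B = B})
≗-trans p q x = trans (p x) (q x)

compositions : ℕ → ℕ → ℕ
compositions zero    zero    = 1
compositions zero    (suc k) = 0
compositions (suc n) k       = sum λ (s : Fin (suc k)) → compositions n (toℕ s)

-- A composition of k into suc n parts is its head k ∸ s followed by a composition of s ≤ k into n parts.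
compositions-count : ∀ n k → HasCount _≗_ (λ (x : Fin n → ℕ) → sum x ≡ k) (compositions n k)
compositions-count zero zero =
  (λ _ ()) , (λ _ → refl) , (λ { zero zero _ → refl }) , λ _ _ → zero , λ ()
compositions-count zero (suc k) = HasCount-∅ {_≈_ = _≗_} λ _ ()
compositions-count (suc n) k =
  HasCount-map ≗-trans (HasCount-↔ (Fin-sum↔Σ (λ s → compositions n (toℕ s))))
    glue glue-sum (λ _ _ → glue-injective) (λ { refl _ → refl }) glue-onto
  where
  tails : ∀ s → Fin (compositions n s) → Fin n → ℕ
  tails s = proj₁ (compositions-count n s)
  tails-sum : ∀ s r → sum (tails s r) ≡ s
  tails-sum s = proj₁ (proj₂ (compositions-count n s))
  tails-injective : ∀ s r r' → tails s r ≗ tails s r' → r ≡ r'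
  tails-injective s = proj₁ (proj₂ (proj₂ (compositions-count n s)))
  tails-onto : ∀ s y → sum y ≡ s → ∃ λ r → y ≗ tails s r
  tails-onto s = proj₂ (proj₂ (proj₂ (compositions-count n s)))

  glue : Σ (Fin (suc k)) (λ s → Fin (compositions n (toℕ s))) → Fin (suc n) → ℕ
  glue (s , r) = (k ∸ toℕ s) ∷ tails (toℕ s) r

  glue-sum : ∀ {p} → ⊤ → sum (glue p) ≡ k
  glue-sum {s , r} _ = begin
    k ∸ toℕ s + sum (tails (toℕ s) r) ≡⟨ cong (k ∸ toℕ s +_) (tails-sum (toℕ s) r) ⟩
    k ∸ toℕ s + toℕ s                 ≡⟨ m∸n+n≡m (s≤s⁻¹ (toℕ<n s)) ⟩
    k                                 ∎
    where open ≡-Reasoning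

  glue-index : ∀ {s r s' r'} → glue (s , r) ≗ glue (s' , r') → s ≡ s'
  glue-index {s} {r} {s'} {r'} eq =
    toℕ-injective (trans (sym (tails-sum _ r)) (trans (sum-cong-≗ (eq ∘ suc)) (tails-sum _ r')))

  glue-injective : ∀ {p p'} → glue p ≗ glue p' → p ≡ p'
  glue-injective {s , r} {s' , r'} eq with glue-index eq
  ... | refl = cong (s ,_) (tails-injective (toℕ s) r r' (eq ∘ suc))

  glue-onto : ∀ {x} → sum x ≡ k → Σ _ λ p → ⊤ × x ≗ glue p
  glue-onto {x} Σx≡k = (s , r) , tt , λ { zero → head-eq ; (suc i) → tail-eq i }
    where
    t = sum (x ∘ suc)
    t<1+k : t < suc k
    t<1+k = s≤s (subst (t ≤_) Σx≡k (m≤n+m t (x zero)))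
    s = fromℕ< t<1+k
    r = proj₁ (tails-onto (toℕ s) (x ∘ suc) (sym (toℕ-fromℕ< t<1+k)))
    tail-eq : x ∘ suc ≗ tails (toℕ s) r
    tail-eq = proj₂ (tails-onto (toℕ s) (x ∘ suc) (sym (toℕ-fromℕ< t<1+k)))
    head-eq : x zero ≡ k ∸ toℕ s
    head-eq = begin
      x zero           ≡⟨ m+n∸n≡m (x zero) t ⟨
      x zero + t ∸ t   ≡⟨ cong₂ _∸_ Σx≡k (sym (toℕ-fromℕ< t<1+k)) ⟩
      k ∸ toℕ s        ∎
      where open ≡-Reasoning

compositions-suc-suc : ∀ n k → compositions (suc n) (suc k) ≡ compositions (suc n) k + compositions n (suc k)
compositions-suc-suc n k = trans (sum-init-last (λ s → compositions n (toℕ s)))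
  (cong₂ _+_ (sum-cong-≗ {suc k} (λ s → cong (compositions n) (toℕ-inject₁ s)))
             (cong (compositions n) (toℕ-fromℕ (suc k))))

compositions-suc-zero : ∀ n → compositions (suc n) 0 ≡ compositions n 0
compositions-suc-zero n = +-identityʳ (compositions n 0)

compositions-binomial : ∀ m k → compositions (suc m) k ≡ (k + m) C m
compositions-binomial zero    zero    = refl
compositions-binomial zero    (suc k) =
  trans (compositions-suc-suc 0 k) (trans (+-identityʳ _) (compositions-binomial zero k))
compositions-binomial (suc m) zero    =
  trans (compositions-suc-zero (suc m)) (trans (compositions-binomial m 0) (trans (nCn≡1 m) (sym (nCn≡1 (suc m)))))
compositions-binomial (suc m) (suc k) = begin
  compositions (suc (suc m)) (suc k)                ≡⟨ compositions-suc-suc (suc m) k ⟩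
  compositions (suc (suc m)) k + compositions (suc m) (suc k)
    ≡⟨ cong₂ _+_ (compositions-binomial (suc m) k) (compositions-binomial m (suc k)) ⟩
  (k + suc m) C suc m + (suc k + m) C m             ≡⟨ cong (λ t → (k + suc m) C suc m + t C m) (+-suc k m) ⟨
  (k + suc m) C suc m + (k + suc m) C m             ≡⟨ +-comm ((k + suc m) C suc m) _ ⟩
  (k + suc m) C m + (k + suc m) C suc m             ≡⟨ nCk+nC[k+1]≡[n+1]C[k+1] (k + suc m) m ⟩
  (suc k + suc m) C suc m                           ∎
  where open ≡-Reasoning

-- A local import: ℤ's +_ would make sections such as (m +_) ambiguous in the rest of the file.
module _ where
  open import Data.Integer using (+_)

  compositions-series : ∀ n → (+_ ∘ compositions n) ⋆ oneMinusTPow n ≗ tPow 0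
  compositions-series = ⋆-oneMinusTPow (λ n → +_ ∘ compositions n) (λ { zero → refl ; (suc k) → refl })
    (λ n → Δ-partialSums (compositions (suc n)) (compositions n) (compositions-suc-zero n) (compositions-suc-suc n))

indicator : {A : Set} → Dec A → ℕ
indicator (yes _) = 1
indicator (no _)  = 0

module _ {A : Set} where

  indicator-witness : (a? : Dec A) → Fin (indicator a?) → A
  indicator-witness (yes a) _ = a

  indicator-intro : (a? : Dec A) → A → Fin (indicator a?)
  indicator-intro (yes _) _ = zero
  indicator-intro (no ¬a) a = contradiction a ¬a

  indicator-unique : (a? : Dec A) (r r' : Fin (indicator a?)) → r ≡ r'
  indicator-unique (yes _) zero zero = refl

  indicator-pos : (a? : Dec A) → A → 0 < indicator a?
  indicator-pos (yes _) _ = s≤s z≤n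
  indicator-pos (no ¬a) a = contradiction a ¬a

  indicator-≤ : ∀ {m} (a? : Dec A) → (A → 0 < m) → indicator a? ≤ m
  indicator-≤ (yes a) 0<m = 0<m a
  indicator-≤ (no _)  _   = z≤n

maxᶠ : ∀ {n} → (Fin n → ℕ) → ℕ
maxᶠ {zero}  x = 0
maxᶠ {suc n} x = x zero ⊔ maxᶠ (x ∘ suc)

maxᶠ-upper : ∀ {n} (x : Fin n → ℕ) j → x j ≤ maxᶠ x
maxᶠ-upper x zero    = m≤m⊔n _ _
maxᶠ-upper x (suc j) = ≤-trans (maxᶠ-upper (x ∘ suc) j) (m≤n⊔m _ _)

maxᶠ-least : ∀ {n} (x : Fin n → ℕ) b → (∀ j → x j ≤ b) → maxᶠ x ≤ b
maxᶠ-least {zero}  x b x≤b = z≤n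
maxᶠ-least {suc n} x b x≤b = ⊔-lub (x≤b zero) (maxᶠ-least (x ∘ suc) b (x≤b ∘ suc))

maxᶠ-cong : ∀ {n} {x y : Fin n → ℕ} → x ≗ y → maxᶠ x ≡ maxᶠ y
maxᶠ-cong {zero}  x≗y = refl
maxᶠ-cong {suc n} x≗y = cong₂ _⊔_ (x≗y zero) (maxᶠ-cong (x≗y ∘ suc))

size : ∀ {d} → Idx d → ℕ
size = Vec.sum

size-+e : ∀ {d} (i : Idx d) ℓ → size (i +e ℓ) ≡ suc (size i)
size-+e (a Vec.∷ i) zero    = refl
size-+e (a Vec.∷ i) (suc ℓ) = trans (cong (a +_) (size-+e i ℓ)) (+-suc a (size i))

Monotone : ∀ {d} → (Idx d → ℕ) → Set
Monotone π = ∀ i ℓ → π (i +e ℓ) ≤ π i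

CountInside : ∀ {d} → (Idx d → ℕ) → ℕ → ℕ → Set
CountInside π₀ k = HasCount _≗ₐ_ (λ π → IsPartition π × ShSub π π₀ × CorIs π k)

CountOnShape : ∀ {d} → (Idx d → ℕ) → ℕ → ℕ → Set
CountOnShape π₀ k = HasCount _≗ₐ_ (λ π → IsPartition π × ShEq π π₀ × CorIs π k)

module _ {d : ℕ} where

  InSh? : (π : Idx d → ℕ) → ∀ i → Dec (InSh π i)
  InSh? π i = ¬? (π i ≟ 0)

  InCr? : (π : Idx d → ℕ) → ∀ i → Dec (InCr π i)
  InCr? π i = InSh? π i ×-dec all? (λ ℓ → ¬? (InSh? π (i +e ℓ)))

  Monotone-zero : ∀ {π : Idx d → ℕ} → Monotone π → ∀ {i} ℓ → π i ≡ 0 → π (i +e ℓ) ≡ 0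
  Monotone-zero mono ℓ πi≡0 = n≤0⇒n≡0 (≤-trans (mono _ ℓ) (≤-reflexive πi≡0))

  ShSub-zero : ∀ {π σ : Idx d → ℕ} → ShSub π σ → ∀ {i} → σ i ≡ 0 → π i ≡ 0
  ShSub-zero π⊆σ σi≡0 = decidable-stable (_ ≟ 0) λ πi≢0 → π⊆σ _ πi≢0 σi≡0

  maxUp : (Idx d → ℕ) → Idx d → ℕ
  maxUp π i = maxᶠ (λ ℓ → π (i +e ℓ))

  cornerCount : (Idx d → ℕ) → Idx d → ℕ
  cornerCount π i = π i ∸ maxUp π i

  maxUp≤ : ∀ {π : Idx d → ℕ} → Monotone π → ∀ i → maxUp π i ≤ π i
  maxUp≤ mono i = maxᶠ-least _ _ (mono i)

  cornerCount-cong : ∀ {π σ : Idx d → ℕ} → π ≗ₐ σ → ∀ i → cornerCount π i ≡ cornerCount σ i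
  cornerCount-cong π≗σ i = cong₂ _∸_ (π≗σ i) (maxᶠ-cong (λ ℓ → π≗σ (i +e ℓ)))

  InCor⇒maxUp< : ∀ {π : Idx d → ℕ} {i h} → InCor π (i , h) → maxUp π i < h
  InCor⇒maxUp< {h = suc h} (_ , not-above) =
    s≤s (maxᶠ-least _ h λ ℓ → s≤s⁻¹ (≰⇒> λ h≤ → not-above ℓ (s≤s z≤n , h≤)))

  maxUp<⇒InCor : ∀ {π : Idx d → ℕ} {i h} → maxUp π i < h → h ≤ π i → InCor π (i , h)
  maxUp<⇒InCor maxUp<h h≤πi =
    (≤-trans (s≤s z≤n) maxUp<h , h≤πi) , λ ℓ (_ , h≤) → <⇒≱ maxUp<h (≤-trans h≤ (maxᶠ-upper _ ℓ))

  cornerCount-Cr : ∀ {π π₀ : Idx d → ℕ} → ShEq π π₀ → ∀ {i} → InCr π₀ i → 0 < cornerCount π i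
  cornerCount-Cr {π} (π⊆π₀ , π₀⊆π) {i} (i∈π₀ , top) = n≢0⇒n>0 λ cc≡0 → π₀⊆π i i∈π₀ (trans πi≡cc cc≡0)
    where
    maxUp≡0 : maxUp π i ≡ 0
    maxUp≡0 = n≤0⇒n≡0 (maxᶠ-least _ 0 λ ℓ → ≤-reflexive
      (decidable-stable (π (i +e ℓ) ≟ 0) λ π≢0 → top ℓ (π⊆π₀ _ π≢0)))
    πi≡cc : π i ≡ cornerCount π i
    πi≡cc = cong (π i ∸_) (sym maxUp≡0)

module CornerDecomposition {d} {π₀ : Idx d → ℕ} (mono₀ : Monotone π₀)
                           {n} (shape : HasCount _≡_ (InSh π₀) n) where

  e : Fin n → Idx d
  e = proj₁ shape

  e∈ρ : ∀ j → InSh π₀ (e j)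
  e∈ρ = proj₁ (proj₂ shape)

  e-injective : ∀ j j' → e j ≡ e j' → j ≡ j'
  e-injective = proj₁ (proj₂ (proj₂ shape))

  e-onto : ∀ {i} → InSh π₀ i → ∃ λ j → i ≡ e j
  e-onto = proj₂ (proj₂ (proj₂ shape)) _

  index : ∀ {i} → InSh π₀ i → Fin n
  index = proj₁ ∘ e-onto

  index-unique : ∀ {i} (i∈ρ : InSh π₀ i) {j} → i ≡ e j → index i∈ρ ≡ j
  index-unique i∈ρ i≡ej = e-injective _ _ (trans (sym (proj₂ (e-onto i∈ρ))) i≡ej)

  bound : ℕ
  bound = maxᶠ (size ∘ e)

  size≤bound : ∀ {i} → InSh π₀ i → size i ≤ bound
  size≤bound i∈ρ with e-onto i∈ρ
  ... | j , refl = maxᶠ-upper (size ∘ e) j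

  shapeInduction : (Q : Idx d → Set) → (∀ i → π₀ i ≡ 0 → Q i) →
                   (∀ i → InSh π₀ i → (∀ ℓ → Q (i +e ℓ)) → Q i) → ∀ i → Q i
  shapeInduction Q outside inside i = go bound i (m≤m+n bound (size i))
    where
    go : ∀ m i → bound ≤ m + size i → Q i
    go m i bound≤ with π₀ i ≟ 0
    ... | yes π₀i≡0 = outside i π₀i≡0
    go zero i bound≤ | no i∈ρ = inside i i∈ρ λ ℓ → outside (i +e ℓ)
      (decidable-stable (π₀ (i +e ℓ) ≟ 0) λ i+eℓ∈ρ →
        1+n≰n (≤-trans (≤-trans (≤-reflexive (sym (size-+e i ℓ))) (size≤bound i+eℓ∈ρ)) bound≤))
    go (suc m) i bound≤ | no i∈ρ = inside i i∈ρ λ ℓ → go m (i +e ℓ)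
      (subst (bound ≤_) (trans (sym (+-suc m (size i))) (cong (m +_) (sym (size-+e i ℓ)))) bound≤)

  buildWith : ℕ → (Fin n → ℕ) → Idx d → ℕ
  buildWith zero    x i = 0
  buildWith (suc m) x i with π₀ i ≟ 0
  ... | yes _   = 0
  ... | no i∈ρ = x (index i∈ρ) + maxᶠ (λ ℓ → buildWith m x (i +e ℓ))

  -- The fuel suc bound ∸ size i drops by one along every step i ↦ i +e ℓ inside ρ, and never runs out there.
  build : (Fin n → ℕ) → Idx d → ℕ
  build x i = buildWith (suc bound ∸ size i) x i

  build-outside : ∀ x {i} → π₀ i ≡ 0 → build x i ≡ 0
  build-outside x {i} π₀i≡0 = go (suc bound ∸ size i)
    where
    go : ∀ m → buildWith m x i ≡ 0
    go zero = refl
    go (suc m) with π₀ i ≟ 0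
    ... | yes _   = refl
    ... | no i∈ρ = contradiction π₀i≡0 i∈ρ

  build-inside : ∀ x {i} (i∈ρ : InSh π₀ i) → build x i ≡ x (index i∈ρ) + maxUp (build x) i
  build-inside x {i} i∈ρ = begin
    buildWith (suc bound ∸ size i) x i
      ≡⟨ cong (λ m → buildWith m x i) (+-∸-assoc 1 (size≤bound i∈ρ)) ⟩
    buildWith (suc (bound ∸ size i)) x i
      ≡⟨ unfold ⟩
    x (index i∈ρ) + maxᶠ (λ ℓ → buildWith (bound ∸ size i) x (i +e ℓ))
      ≡⟨ cong (x (index i∈ρ) +_) (maxᶠ-cong λ ℓ → cong (λ s → buildWith (suc bound ∸ s) x (i +e ℓ)) (size-+e i ℓ)) ⟨
    x (index i∈ρ) + maxUp (build x) i ∎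
    where
    open ≡-Reasoning
    unfold : buildWith (suc (bound ∸ size i)) x i ≡ x (index i∈ρ) + maxᶠ (λ ℓ → buildWith (bound ∸ size i) x (i +e ℓ))
    unfold with π₀ i ≟ 0
    ... | yes π₀i≡0 = contradiction π₀i≡0 i∈ρ
    ... | no i∈ρ′  = cong (λ j → x j + maxᶠ (λ ℓ → buildWith (bound ∸ size i) x (i +e ℓ))) (index-unique i∈ρ′ (proj₂ (e-onto i∈ρ)))

  build-cong : ∀ {x x'} → x ≗ x' → build x ≗ build x'
  build-cong {x} {x'} x≗x' = shapeInduction (λ i → build x i ≡ build x' i)
    (λ i π₀i≡0 → trans (build-outside x π₀i≡0) (sym (build-outside x' π₀i≡0)))
    (λ i i∈ρ ih → trans (build-inside x i∈ρ)
                    (trans (cong₂ _+_ (x≗x' (index i∈ρ)) (maxᶠ-cong ih)) (sym (build-inside x' i∈ρ))))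

  build-monotone : ∀ x → Monotone (build x)
  build-monotone x i ℓ with π₀ i ≟ 0
  ... | yes π₀i≡0 = ≤-reflexive (trans (build-outside x (Monotone-zero mono₀ ℓ π₀i≡0))
                                       (sym (build-outside x π₀i≡0)))
  ... | no i∈ρ   = ≤-trans (maxᶠ-upper _ ℓ)
                     (≤-trans (m≤n+m _ (x (index i∈ρ))) (≤-reflexive (sym (build-inside x i∈ρ))))

  build-⊆ : ∀ x → ShSub (build x) π₀
  build-⊆ x i buildi≢0 π₀i≡0 = buildi≢0 (build-outside x π₀i≡0)

  build-isPartition : ∀ x → IsPartition (build x)
  build-isPartition x = build-monotone x , tabulate e , λ i buildi≢0 → listed (build-⊆ x i buildi≢0)
    where
    listed : ∀ {i} → InSh π₀ i → i ∈ tabulate e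
    listed i∈ρ with e-onto i∈ρ
    ... | j , refl = ∈-tabulate⁺ j

  cornerCount-build : ∀ x → cornerCount (build x) ∘ e ≗ x
  cornerCount-build x j = begin
    build x (e j) ∸ maxUp (build x) (e j)                       ≡⟨ cong (_∸ maxUp (build x) (e j)) (build-inside x (e∈ρ j)) ⟩
    x (index (e∈ρ j)) + maxUp (build x) (e j) ∸ maxUp (build x) (e j) ≡⟨ m+n∸n≡m _ (maxUp (build x) (e j)) ⟩
    x (index (e∈ρ j))                                           ≡⟨ cong x (index-unique (e∈ρ j) refl) ⟩
    x j                                                         ∎
    where open ≡-Reasoning

  build-cornerCount : ∀ {π} → Monotone π → ShSub π π₀ → π ≗ build (cornerCount π ∘ e)
  build-cornerCount {π} mono π⊆ρ = shapeInduction (λ i → π i ≡ build x i)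
    (λ i π₀i≡0 → trans (ShSub-zero π⊆ρ π₀i≡0) (sym (build-outside x π₀i≡0)))
    step
    where
    x = cornerCount π ∘ e
    step : ∀ i → InSh π₀ i → (∀ ℓ → π (i +e ℓ) ≡ build x (i +e ℓ)) → π i ≡ build x i
    step i i∈ρ ih = begin
      π i                                        ≡⟨ m∸n+n≡m (maxUp≤ mono i) ⟨
      cornerCount π i + maxUp π i                ≡⟨ cong₂ _+_ (cong (cornerCount π) (proj₂ (e-onto i∈ρ))) (maxᶠ-cong ih) ⟩
      x (index i∈ρ) + maxUp (build x) i          ≡⟨ build-inside x i∈ρ ⟨
      build x i                                  ∎
      where open ≡-Reasoning

  -- The corners of column e j are the heights maxUp π (e j) + 1, …, π (e j).
  corners-count : ∀ {π} → Monotone π → ShSub π π₀ → HasCount _≡_ (InCor π) (sum (cornerCount π ∘ e))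
  corners-count {π} mono π⊆ρ =
    HasCount-map trans (HasCount-↔ (Fin-sum↔Σ (cornerCount π ∘ e))) corner
      (λ {(j , r)} _ → corner-InCor j r) (λ _ _ → corner-injective) (λ { refl → refl }) corner-onto
    where
    corner : Σ (Fin n) (Fin ∘ cornerCount π ∘ e) → Idx d × ℕ
    corner (j , r) = e j , maxUp π (e j) + suc (toℕ r)

    corner-InCor : ∀ j (r : Fin (cornerCount π (e j))) → InCor π (corner (j , r))
    corner-InCor j r = maxUp<⇒InCor {π = π} (m<m+n _ (s≤s z≤n)) (begin
      maxUp π (e j) + suc (toℕ r)          ≤⟨ +-monoʳ-≤ (maxUp π (e j)) (toℕ<n r) ⟩
      maxUp π (e j) + cornerCount π (e j)  ≡⟨ m+[n∸m]≡n (maxUp≤ mono (e j)) ⟩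
      π (e j)                              ∎)
      where open ≤-Reasoning

    corner-injective : ∀ {p p'} → corner p ≡ corner p' → p ≡ p'
    corner-injective {j , r} {j' , r'} eq with e-injective j j' (cong proj₁ eq)
    ... | refl = cong (j ,_) (toℕ-injective (suc-injective (+-cancelˡ-≡ _ _ _ (cong proj₂ eq))))

    corner-onto : ∀ {p} → InCor π p → Σ _ λ q → ⊤ × p ≡ corner q
    corner-onto {i , h} c@((1≤h , h≤πi) , _) with e-onto (π⊆ρ i λ πi≡0 → 1+n≰n (≤-trans 1≤h (≤-trans h≤πi (≤-reflexive πi≡0))))
    ... | j , refl = (j , fromℕ< r<cc) , tt , cong (e j ,_) (sym h≡corner)
      where
      M = maxUp π (e j)
      M<h : M < h
      M<h = InCor⇒maxUp< {π = π} c
      r<cc : h ∸ suc M < cornerCount π (e j)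
      r<cc = subst (_≤ cornerCount π (e j)) (+-∸-assoc 1 M<h) (∸-monoˡ-≤ M h≤πi)
      h≡corner : M + suc (toℕ (fromℕ< r<cc)) ≡ h
      h≡corner = trans (cong (λ t → M + suc t) (toℕ-fromℕ< r<cc)) (trans (+-suc M _) (m+[n∸m]≡n M<h))

  build-corners : ∀ x → CorIs (build x) (sum x)
  build-corners x = subst (CorIs (build x)) (sum-cong-≗ (cornerCount-build x))
                          (corners-count (build-monotone x) (build-⊆ x))

  build-injective : ∀ {x x'} → build x ≗ₐ build x' → x ≗ x'
  build-injective {x} {x'} eq j =
    trans (sym (cornerCount-build x j)) (trans (cornerCount-cong eq (e j)) (cornerCount-build x' j))

  crIndicator : Fin n → ℕ
  crIndicator j = indicator (InCr? π₀ (e j))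

  Cr-count : HasCount _≡_ (InCr π₀) (sum crIndicator)
  Cr-count = HasCount-map {Q = InCr π₀} trans (HasCount-↔ (Fin-sum↔Σ crIndicator)) (e ∘ proj₁)
    (λ {(j , r)} _ → indicator-witness (InCr? π₀ (e j)) r) at-injective (λ { refl → refl }) onto
    where
    at-injective : ∀ p p' → e (proj₁ p) ≡ e (proj₁ p') → p ≡ p'
    at-injective (j , r) (j' , r') eq with e-injective j j' eq
    ... | refl = cong (j ,_) (indicator-unique (InCr? π₀ (e j)) r r')
    onto : ∀ {i} → InCr π₀ i → Σ _ λ p → ⊤ × i ≡ e (proj₁ p)
    onto cr with e-onto (proj₁ cr)
    ... | j , refl = (j , indicator-intro (InCr? π₀ (e j)) cr) , tt , refl

  build-⊇ : ∀ x → (∀ j → InCr π₀ (e j) → 0 < x j) → ShSub π₀ (build x)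
  build-⊇ x x-pos = shapeInduction (λ i → InSh π₀ i → InSh (build x) i)
    (λ i π₀i≡0 i∈ρ → contradiction π₀i≡0 i∈ρ) step
    where
    step : ∀ i → InSh π₀ i → (∀ ℓ → InSh π₀ (i +e ℓ) → InSh (build x) (i +e ℓ)) → InSh π₀ i → InSh (build x) i
    step i i∈ρ ih _ with e-onto i∈ρ
    ... | j , refl with InCr? π₀ (e j)
    ...   | yes cr = λ build≡0 → <⇒≢ (≤-trans (x-pos j cr) (m≤m+n _ _))
                       (sym (trans (cong (_+ maxUp (build x) (e j)) (cong x (sym (index-unique i∈ρ refl))))
                         (trans (sym (build-inside x i∈ρ)) build≡0)))
    ...   | no ¬cr = λ build≡0 → ih ℓ above (Monotone-zero {π = build x} (build-monotone x) {e j} ℓ build≡0)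
      where
      exists-above = ¬∀⟶∃¬ d (λ ℓ → ¬ InSh π₀ (e j +e ℓ)) (λ ℓ → ¬? (InSh? π₀ (e j +e ℓ))) (λ top → ¬cr (i∈ρ , top))
      ℓ = proj₁ exists-above
      above : InSh π₀ (e j +e ℓ)
      above = decidable-stable (InSh? π₀ (e j +e ℓ)) (proj₂ exists-above)

  count-inside : ∀ k → CountInside π₀ k (compositions n k)
  count-inside k = HasCount-map ≗-trans (compositions-count n k) build
    (λ {x} Σx≡k → build-isPartition x , build-⊆ x , subst (CorIs (build x)) Σx≡k (build-corners x))
    (λ _ _ → build-injective) build-cong
    (λ {π} ((mono , _) , π⊆ρ , cor) → cornerCount π ∘ e ,
       HasCount-unique (corners-count mono π⊆ρ) cor , build-cornerCount mono π⊆ρ)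

  onShape : (Fin n → ℕ) → Idx d → ℕ
  onShape y = build (λ j → crIndicator j + y j)

  onShape-decompose : ∀ {π k} → IsPartition π × ShEq π π₀ × CorIs π k →
                      Σ (Fin n → ℕ) λ y → sum crIndicator + sum y ≡ k × π ≗ₐ onShape y
  onShape-decompose {π} {k} ((mono , _) , sh@(π⊆ρ , _) , cor) = y , sum-y , π≗onShape
    where
    y : Fin n → ℕ
    y j = cornerCount π (e j) ∸ crIndicator j
    ind+y : ∀ j → crIndicator j + y j ≡ cornerCount π (e j)
    ind+y j = m+[n∸m]≡n (indicator-≤ (InCr? π₀ (e j)) (cornerCount-Cr sh))
    sum-y : sum crIndicator + sum y ≡ k
    sum-y = begin
      sum crIndicator + sum y               ≡⟨ ∑-distrib-+ crIndicator y ⟨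
      sum (λ j → crIndicator j + y j)       ≡⟨ sum-cong-≗ ind+y ⟩
      sum (cornerCount π ∘ e)               ≡⟨ HasCount-unique (corners-count mono π⊆ρ) cor ⟩
      k                                     ∎
      where open ≡-Reasoning
    π≗onShape : π ≗ₐ onShape y
    π≗onShape i = trans (build-cornerCount mono π⊆ρ i) (build-cong (sym ∘ ind+y) i)

  count-onShape : ∀ k → CountOnShape π₀ (sum crIndicator + k) (compositions n k)
  count-onShape k = HasCount-map ≗-trans (compositions-count n k) onShape
    (λ {y} Σy≡k → build-isPartition _ ,
       (build-⊆ _ , build-⊇ _ (λ j cr → ≤-trans (indicator-pos (InCr? π₀ (e j)) cr) (m≤m+n _ _))) ,
       subst (CorIs (onShape y)) (trans (∑-distrib-+ crIndicator y) (cong (sum crIndicator +_) Σy≡k))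
             (build-corners _))
    (λ y y' eq j → +-cancelˡ-≡ (crIndicator j) _ _ (build-injective eq j))
    (λ y≗y' → build-cong (λ j → cong (crIndicator j +_) (y≗y' j)))
    (λ h → let (y , sum-y , π≗onShape) = onShape-decompose h
           in y , +-cancelˡ-≡ (sum crIndicator) _ _ sum-y , π≗onShape)

  count-onShape-< : ∀ k → k < sum crIndicator → CountOnShape π₀ k 0
  count-onShape-< k k<c = HasCount-∅ {_≈_ = _≗ₐ_} λ π h →
    let (y , sum-y , _) = onShape-decompose h in <⇒≱ k<c (subst (sum crIndicator ≤_) sum-y (m≤m+n _ _))

  count-onShape-shift : ∀ {c} → HasCount _≡_ (InCr π₀) c → ∀ k → CountOnShape π₀ k (shift 0 c (compositions n) k)
  count-onShape-shift c-count with HasCount-unique c-count Cr-count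
  ... | refl = shift-elim (CountOnShape π₀) (sum crIndicator) count-onShape-< count-onShape

open import Data.Integer using (+_)

corollary5p7 : (d : ℕ) (π₀ : Idx d → ℕ) → IsPartition π₀ →
    (n c : ℕ) → HasCount _≡_ (InSh π₀) n → HasCount _≡_ (InCr π₀) c →
    (Σ (ℕ → ℕ) λ a →
      (∀ k → HasCount _≗ₐ_ (λ π → IsPartition π × ShSub π π₀ × CorIs π k) (a k)) ×
      SeriesEq ((λ k → + a k) ⋆ oneMinusTPow n) (tPow 0)) ×
    (Σ (ℕ → ℕ) λ b →
      (∀ k → HasCount _≗ₐ_ (λ π → IsPartition π × ShEq π π₀ × CorIs π k) (b k)) ×
      SeriesEq ((λ k → + b k) ⋆ oneMinusTPow n) (tPow c)) ×
    ((m : ℕ) → n ≡ suc m → (k : ℕ) →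
      (k < c → HasCount _≗ₐ_ (λ π → IsPartition π × ShEq π π₀ × CorIs π k) 0) ×
      (k ≥ c → HasCount _≗ₐ_ (λ π → IsPartition π × ShEq π π₀ × CorIs π k) ((k ∸ c + m) C m)))
corollary5p7 d π₀ (mono₀ , _) n c shape-count cr-count =
  (compositions n , count-inside , compositions-series n) ,
  (shift 0 c (compositions n) , count , shifted-series) ,
  binomial-counts
  where
  open CornerDecomposition mono₀ shape-count

  count : ∀ k → CountOnShape π₀ k (shift 0 c (compositions n) k)
  count = count-onShape-shift cr-count

  shifted-series : (+_ ∘ shift 0 c (compositions n)) ⋆ oneMinusTPow n ≗ tPow c
  shifted-series k = trans (⋆-congˡ (oneMinusTPow n) (map-shift +_ 0 c (compositions n)) k)
                           (shift-⋆-tPow c (oneMinusTPow n) (compositions-series n) k)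

  binomial-counts : ∀ m → n ≡ suc m → ∀ k →
                    (k < c → CountOnShape π₀ k 0) × (k ≥ c → CountOnShape π₀ k ((k ∸ c + m) C m))
  binomial-counts m refl k =
    (λ k<c → subst (CountOnShape π₀ k) (shift-< k<c) (count k)) ,
    (λ c≤k → subst (CountOnShape π₀ k) (trans (shift-≥ c≤k) (compositions-binomial m (k ∸ c))) (count k))
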